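{- Let $G$ be a ONE-ONE-LQ instance, $M_s$ a stable matching of $G$, and $G'$ the instance obtained by the marking construction described in the context. For any integer $k$, if $G'$ admits a feasible, envy-free matching of size $k$, then $G$ admits a feasible, envy-free matching of size $k$.
   Context: ONE-ONE-LQ instance: bipartite graph $G=(\mathcal{A}\cup\mathcal{B},E)$ of agents and resources, each vertex with a strict preference order over its neighbours ($\succ_u$), each resource with upper-quota $1$ and lower-quota in $\{0,1\}$ (LQ resource if lower-quota $1$). Matching: each vertex in at most one edge; $M(v)$ partner or $\bot$ (least preferred). Feasible: every LQ resource matched. Blocking pair $(a,b)\in E\setminus M$: $b\succ_a M(a)$ and $a\succ_b M(b)$; stable: no blocking pair. Envy: $a$ envies matched $a'$ with $M(a')=b$ if $(a,b)\in E$, $b\succ_a M(a)$, $a\succ_b a'$; envy-free: no envy. $\ell(v)$ = length of $v$'s list; $s=|M_s|$. Construction: let $X_A$ (resp. $X_B$) be the agents (resp. resources) matched in $M_s$ and $I$ the remaining vertices. Mark edges in order: (1) for every $a\in X_A$ and every LQ resource $b$ adjacent to $a$, mark $(a,b)$; (2) for every $b\in X_B$, mark the $\min(s+1,\ell(b))$ most preferred edges of $b$; (3) for every $a\in X_A$, let $C_a$ be the set of non-LQ resources $b$ in $a$'s list that also appear in the list of some $a'\in X_A$, $a'\ne a$, and mark $(a,b)$ for all $b\in C_a$; (4) for every $a\in X_A$, among the still-unmarked edges incident to $a$ (if any), mark the one to $a$'s most preferred resource. $G'$ is the ONE-ONE-LQ instance formed by the marked edges and their endpoints, with the same quotas and preference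 lists of $G$ restricted to neighbours in $G'$. -}

module Defs where

open import Data.Nat using (ℕ; suc; _<_)
open import Data.Bool using (Bool; true; false; T; _∧_; _∨_; not)
open import Data.Fin using (Fin; toℕ; _≟_)
open import Data.List using (List; length; filterᵇ; head; take; lookup)
open import Data.Bool.ListAction using (any)
open import Data.List.Membership.Propositional using (_∈_)
open import Data.List.Relation.Unary.Unique.Propositional using (Unique)
open import Data.Maybe using (Maybe; just; nothing; is-just)
open import Data.Product using (Σ; ∃; _×_; _,_)
open import Data.Fin using () renaming (_≟_ to _≟F_)
open import Data.List using (allFin)
open import Relation.Nullary using (¬_)
open import Relation.Nullary.Decidable using (⌊_⌋)
open import Relation.Binary.PropositionalEquality using (_≡_; _≢_)
open import Function using (_∘_; _⇔_)

-- Each vertex has a preference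
-- list (earlier = more preferred); neighbours = elements of the list.
-- Upper quotas are all 1 (built into the notion of matching), and the
-- lower quota of a resource is 1 iff lq b = true (LQ resource), else 0.

record Instance (nA nB : ℕ) : Set where
  field
    prefA : Fin nA → List (Fin nB)
    prefB : Fin nB → List (Fin nA)
    lq    : Fin nB → Bool
open Instance public

record WellFormed {nA nB : ℕ} (I : Instance nA nB) : Set where
  field
    uniqueA : ∀ a → Unique (prefA I a)
    uniqueB : ∀ b → Unique (prefB I b)
    symm    : ∀ a b → (b ∈ prefA I a) ⇔ (a ∈ prefB I b)

Prefers : {n : ℕ} → List (Fin n) → Fin n → Fin n → Set
Prefers L x y = Σ _ λ i → Σ _ λ j →
  (lookup L i ≡ x) × (lookup L j ≡ y) × (toℕ i < toℕ j)

PrefersOpt : {n : ℕ} → List (Fin n) → Fin n → Maybe (Fin n) → Set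
PrefersOpt L x nothing  = x ∈ L
PrefersOpt L x (just y) = Prefers L x y

Matching : ℕ → ℕ → Set
Matching nA nB = Fin nA → Maybe (Fin nB)

record IsMatching {nA nB : ℕ} (I : Instance nA nB) (M : Matching nA nB) : Set where
  field
    edge   : ∀ a b → M a ≡ just b → b ∈ prefA I a
    injRes : ∀ a a' b → M a ≡ just b → M a' ≡ just b → a ≡ a'

size : {nA nB : ℕ} → Matching nA nB → ℕ
size {nA} M = length (filterᵇ (is-just ∘ M) (allFin nA))

Feasible : {nA nB : ℕ} → Instance nA nB → Matching nA nB → Set
Feasible {nA} {nB} I M = ∀ (b : Fin nB) → T (lq I b) → ∃ λ (a : Fin nA) → M a ≡ just b

-- a ≻_b M(b): a is a neighbour of b and strictly preferred by b to
-- b's partner (if b is unmatched, M(b) = ⊥ and any neighbour is preferred)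
ResPrefers : {nA nB : ℕ} → Instance nA nB → Matching nA nB → Fin nB → Fin nA → Set
ResPrefers I M b a = (a ∈ prefB I b) × (∀ a' → M a' ≡ just b → Prefers (prefB I b) a a')

BlockingPair : {nA nB : ℕ} → Instance nA nB → Matching nA nB → Fin nA → Fin nB → Set
BlockingPair I M a b =
  (b ∈ prefA I a) × (M a ≢ just b) × PrefersOpt (prefA I a) b (M a) × ResPrefers I M b a

Stable : {nA nB : ℕ} → Instance nA nB → Matching nA nB → Set
Stable I M = ∀ a b → ¬ BlockingPair I M a b

Envies : {nA nB : ℕ} → Instance nA nB → Matching nA nB → Fin nA → Fin nA → Fin nB → Set
Envies I M a a' b =
  (M a' ≡ just b) × (b ∈ prefA I a) × PrefersOpt (prefA I a) b (M a) × Prefers (prefB I b) a a'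

EnvyFree : {nA nB : ℕ} → Instance nA nB → Matching nA nB → Set
EnvyFree I M = ∀ a a' b → ¬ Envies I M a a' b

elemᵇ : {n : ℕ} → Fin n → List (Fin n) → Bool
elemᵇ x L = any (λ y → ⌊ y ≟F x ⌋) L

matchesᵇ : {n : ℕ} → Maybe (Fin n) → Fin n → Bool
matchesᵇ nothing  x = false
matchesᵇ (just y) x = ⌊ y ≟F x ⌋

module Marking {nA nB : ℕ} (I : Instance nA nB) (Ms : Matching nA nB) where

  s : ℕ
  s = size Ms

  inXA : Fin nA → Bool
  inXA a = is-just (Ms a)

  inXB : Fin nB → Bool
  inXB b = any (λ a → matchesᵇ (Ms a) b) (allFin nA)

  mark1 : Fin nA → Fin nB → Bool
  mark1 a b = inXA a ∧ lq I b

  mark2 : Fin nA → Fin nB → Bool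
  mark2 a b = inXB b ∧ elemᵇ a (take (suc s) (prefB I b))

  mark3 : Fin nA → Fin nB → Bool
  mark3 a b = inXA a ∧ not (lq I b) ∧
    any (λ a' → inXA a' ∧ not ⌊ a' ≟F a ⌋ ∧ elemᵇ b (prefA I a')) (allFin nA)

  mark123 : Fin nA → Fin nB → Bool
  mark123 a b = elemᵇ b (prefA I a) ∧ (mark1 a b ∨ mark2 a b ∨ mark3 a b)

  mark4 : Fin nA → Fin nB → Bool
  mark4 a b = inXA a ∧ matchesᵇ (head (filterᵇ (λ b' → not (mark123 a b')) (prefA I a))) b

  marked : Fin nA → Fin nB → Bool
  marked a b = elemᵇ b (prefA I a) ∧ (mark123 a b ∨ mark4 a b)

  -- G': marked edges, same quotas, preference lists restricted.
  -- (Vertex sets are kept; vertices with no marked edge are isolated.)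
  G' : Instance nA nB
  G' = record
    { prefA = λ a → filterᵇ (λ b → marked a b) (prefA I a)
    ; prefB = λ b → filterᵇ (λ a → marked a b) (prefB I b)
    ; lq    = lq I
    }

markedInstance : {nA nB : ℕ} → Instance nA nB → Matching nA nB → Instance nA nB
markedInstance I Ms = Marking.G' I Ms

{-# OPTIONS --safe #-}
-- Only envy-freeness of M' in G needs an argument, and envy along a marked edge is ruled out
-- by envy-freeness in G'.  The crux is that every agent matched by M' is matched by Ms.  If
-- x ∉ X_A had M'(x) = c, then the Ms-holder of c would (by stability of Ms and envy-freeness of
-- M' on its marked edge) strictly prefer its M'-partner to its Ms-partner; iterating
-- "the Ms-holder of my M'-partner" from x gives an injection of these upgraded agents together
-- with x into the upgraded agents, which is impossible.  Hence if a envies a' for b = M'(a'),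
-- the edge (a, b) is marked: by steps (1)/(3) with rival a' when a ∈ X_A, and by step (2)
-- otherwise, since stability then puts b in X_B and a among b's first s + 1 agents.
module Submission where

open import Data.Nat using (ℕ; zero; suc; _≤_; z≤n; s≤s)
open import Data.Nat.Properties using (n≮n)
open import Data.Bool using (true; false; T; _∨_)
open import Data.Bool.Properties using (T-∧; T-∨; T-≡; T-not-≡)
open import Data.Unit using (tt)
open import Data.Empty using (⊥-elim)
open import Data.Fin using (Fin; _≟_)
import Data.Fin as Fin
open import Data.Fin.Properties using (any?)
open import Data.Maybe using (Maybe; just; nothing; is-just)
open import Data.Maybe.Properties using (just-injective; ≡-dec)
open import Data.List using (List; []; _∷_; length; filter; take; allFin; removeAt)
open import Data.List.Properties using (length-removeAt′)
open import Data.List.Membership.Propositional using (_∈_; _∉_; lose)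
open import Data.List.Membership.Propositional.Properties
  using (∈-filter⁺; ∈-filter⁻; ∈-allFin; ∈-lookup)
open import Data.List.Relation.Unary.Any as Any using (here; there; index)
open import Data.List.Relation.Unary.Any.Properties using (any⁺; any⁻; lookup-index)
open import Data.List.Relation.Unary.All as All using (All; []; _∷_)
open import Data.List.Relation.Unary.All.Properties using (¬Any⇒All¬)
open import Data.List.Relation.Unary.AllPairs using ([]; _∷_)
open import Data.List.Relation.Unary.Unique.Propositional using (Unique)
open import Data.List.Relation.Unary.Unique.Propositional.Properties using (take⁺; filter⁺; allFin⁺)
open import Data.Product using (∃; ∃₂; _×_; _,_; proj₁; proj₂)
open import Data.Sum using (_⊎_; inj₁; inj₂)
open import Function using (_∘_; case_of_; Equivalence)
open import Relation.Binary.Definitions using (DecidableEquality)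
open import Relation.Binary.PropositionalEquality using (_≡_; _≢_; refl; sym; trans; cong; subst)
open import Relation.Nullary using (¬_; Dec; yes; no)
open import Relation.Nullary.Decidable
  using (map′; _×-dec_; _⊎-dec_; toWitness; fromWitness; fromWitnessFalse; T?)
open import Relation.Unary using (Decidable)
open import Defs

open Equivalence using (to; from)

private
  variable
    A B : Set
    x y z : A
    L : List A

∈-removeAt⁺ : ∀ {ys : List A} (p : x ∈ ys) → z ∈ ys → z ≢ x → z ∈ removeAt ys (index p)
∈-removeAt⁺ (here refl) (here refl) z≢x = ⊥-elim (z≢x refl)
∈-removeAt⁺ (here refl) (there z∈ys) _ = z∈ys
∈-removeAt⁺ (there p) (here refl) _ = here refl
∈-removeAt⁺ (there p) (there z∈ys) z≢x = there (∈-removeAt⁺ p z∈ys z≢x)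

injective-relation⇒length≤ : ∀ {xs : List A} {ys : List B} {R : A → B → Set} →
  (∀ {u v w} → R u w → R v w → u ≡ v) → Unique xs →
  (∀ {u} → u ∈ xs → ∃ λ w → w ∈ ys × R u w) → length xs ≤ length ys
injective-relation⇒length≤ _ [] _ = z≤n
injective-relation⇒length≤ {xs = x ∷ xs} {ys} {R} inj (x∉xs ∷ xs!) image
  with image (here refl)
... | w , w∈ys , Rxw =
  subst (suc (length xs) ≤_) (sym (length-removeAt′ ys (index w∈ys)))
    (s≤s (injective-relation⇒length≤ inj xs! image'))
  where
  image' : ∀ {u} → u ∈ xs → ∃ λ w' → w' ∈ removeAt ys (index w∈ys) × R u w'
  image' u∈xs with image (there u∈xs)
  ... | w' , w'∈ys , Ruw' =
    w' , ∈-removeAt⁺ w∈ys w'∈ys (λ { refl → All.lookup x∉xs u∈xs (sym (inj Ruw' Rxw)) }) , Ruw'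

∈-take⁻ : ∀ k (L : List A) → x ∈ take k L → x ∈ L
∈-take⁻ (suc k) (w ∷ L) (here refl) = here refl
∈-take⁻ (suc k) (w ∷ L) (there x∈) = there (∈-take⁻ k L x∈)

length-take-∉ : ∀ k (L : List A) → y ∈ L → y ∉ take k L → length (take k L) ≡ k
length-take-∉ zero L _ _ = refl
length-take-∉ (suc k) (w ∷ L) (here refl) y∉ = ⊥-elim (y∉ (here refl))
length-take-∉ (suc k) (w ∷ L) (there y∈L) y∉ = cong suc (length-take-∉ k L y∈L (y∉ ∘ there))

just-or-nothing : (m : Maybe A) → (∃ λ x → m ≡ just x) ⊎ m ≡ nothing
just-or-nothing (just x) = inj₁ (x , refl)
just-or-nothing nothing = inj₂ refl

data Before {A : Set} : List A → A → A → Set where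
  here  : y ∈ L → Before (x ∷ L) x y
  there : Before L x y → Before (z ∷ L) x y

Before⇒∈ˡ : Before L x y → x ∈ L
Before⇒∈ˡ (here _) = here refl
Before⇒∈ˡ (there p) = there (Before⇒∈ˡ p)

Before⇒∈ʳ : Before L x y → y ∈ L
Before⇒∈ʳ (here y∈L) = there y∈L
Before⇒∈ʳ (there p) = there (Before⇒∈ʳ p)

Before-total : x ∈ L → y ∈ L → x ≢ y → Before L x y ⊎ Before L y x
Before-total (here refl) (here refl) x≢y = ⊥-elim (x≢y refl)
Before-total (here refl) (there y∈L) _ = inj₁ (here y∈L)
Before-total (there x∈L) (here refl) _ = inj₂ (here x∈L)
Before-total (there x∈L) (there y∈L) x≢y with Before-total x∈L y∈L x≢y
... | inj₁ p = inj₁ (there p)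
... | inj₂ p = inj₂ (there p)

Before-irrefl : Unique L → ¬ Before L x x
Before-irrefl (x∉L ∷ _) (here x∈L) = All.lookup x∉L x∈L refl
Before-irrefl (_ ∷ L!) (there p) = Before-irrefl L! p

Before-trans : Unique L → Before L x y → Before L y z → Before L x z
Before-trans _ (here _) (there q) = here (Before⇒∈ʳ q)
Before-trans (w∉L ∷ _) (here y∈L) (here _) = ⊥-elim (All.lookup w∉L y∈L refl)
Before-trans (w∉L ∷ _) (there p) (here _) = ⊥-elim (All.lookup w∉L (Before⇒∈ʳ p) refl)
Before-trans (_ ∷ L!) (there p) (there q) = there (Before-trans L! p q)

Before-asym : Unique L → Before L x y → ¬ Before L y x
Before-asym L! p q = Before-irrefl L! (Before-trans L! p q)

Before? : DecidableEquality A → (L : List A) (x y : A) → Dec (Before L x y)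
Before? _ [] _ _ = no λ ()
Before? _≟ᴬ_ (w ∷ L) x y =
  map′ (λ { (inj₁ (refl , y∈L)) → here y∈L ; (inj₂ p) → there p })
       (λ { (here y∈L) → inj₁ (refl , y∈L) ; (there p) → inj₂ p })
       ((w ≟ᴬ x ×-dec Any.any? (y ≟ᴬ_) L) ⊎-dec Before? _≟ᴬ_ L x y)

take-Before : ∀ k (L : List A) → x ∈ take k L → y ∈ L → y ∉ take k L → Before L x y
take-Before (suc k) (w ∷ L) _ (here refl) y∉ = ⊥-elim (y∉ (here refl))
take-Before (suc k) (w ∷ L) (here refl) (there y∈L) _ = here y∈L
take-Before (suc k) (w ∷ L) (there x∈) (there y∈L) y∉ =
  there (take-Before k L x∈ y∈L (y∉ ∘ there))

Before-take : ∀ k → Unique L → Before L x y → y ∈ take k L → x ∈ take k L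
Before-take (suc k) _ (here _) _ = here refl
Before-take (suc k) (w∉L ∷ _) (there p) (here refl) = ⊥-elim (All.lookup w∉L (Before⇒∈ʳ p) refl)
Before-take (suc k) (_ ∷ L!) (there p) (there y∈) = there (Before-take k L! p y∈)

module _ {P : A → Set} (P? : Decidable P) where

  Before-filter⁻ : ∀ L → Before (filter P? L) x y → Before L x y
  Before-filter⁻ (w ∷ L) p with P? w
  ... | no _ = there (Before-filter⁻ L p)
  Before-filter⁻ (w ∷ L) (here y∈) | yes _ = here (proj₁ (∈-filter⁻ P? y∈))
  Before-filter⁻ (w ∷ L) (there p) | yes _ = there (Before-filter⁻ L p)

  Before-filter⁺ : P x → P y → Before L x y → Before (filter P? L) x y
  Before-filter⁺ {x = x} Px Py (here y∈L) with P? x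
  ... | yes _ = here (∈-filter⁺ P? y∈L Py)
  ... | no ¬Px = ⊥-elim (¬Px Px)
  Before-filter⁺ Px Py (there {z = w} p) with P? w
  ... | yes _ = there (Before-filter⁺ Px Py p)
  ... | no _ = Before-filter⁺ Px Py p

module _ {n : ℕ} where

  Prefers⇒Before : ∀ (L : List (Fin n)) {x y} → Prefers L x y → Before L x y
  Prefers⇒Before (w ∷ L) (Fin.zero , Fin.suc j , refl , refl , _) = here (∈-lookup j)
  Prefers⇒Before (w ∷ L) (Fin.suc i , Fin.suc j , refl , refl , s≤s i<j) =
    there (Prefers⇒Before L (i , j , refl , refl , i<j))

  Before⇒Prefers : ∀ {L : List (Fin n)} {x y} → Before L x y → Prefers L x y
  Before⇒Prefers (here y∈L) = Fin.zero , Fin.suc (index y∈L) , refl , sym (lookup-index y∈L) , s≤s z≤n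
  Before⇒Prefers (there p) with Before⇒Prefers p
  ... | i , j , refl , refl , i<j = Fin.suc i , Fin.suc j , refl , refl , s≤s i<j

  T-elemᵇ⁻ : ∀ {x : Fin n} L → T (elemᵇ x L) → x ∈ L
  T-elemᵇ⁻ L t = Any.map (sym ∘ toWitness) (any⁻ _ L t)

  T-elemᵇ⁺ : ∀ {x : Fin n} {L} → x ∈ L → T (elemᵇ x L)
  T-elemᵇ⁺ x∈L = any⁺ _ (Any.map (fromWitness ∘ sym) x∈L)

  T-matchesᵇ⁺ : ∀ {m : Maybe (Fin n)} {y} → m ≡ just y → T (matchesᵇ m y)
  T-matchesᵇ⁺ refl = fromWitness refl

module MarkedInstance {nA nB : ℕ} (I : Instance nA nB) (wf : WellFormed I)
  (Ms : Matching nA nB) (isMs : IsMatching I Ms) (stable : Stable I Ms) where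

  open Marking I Ms
  open WellFormed wf
  open IsMatching

  private
    variable
      a a' w : Fin nA
      b c c' d : Fin nB

  ∈prefA⇒∈prefB : b ∈ prefA I a → a ∈ prefB I b
  ∈prefA⇒∈prefB = to (symm _ _)

  ∈prefB⇒∈prefA : a ∈ prefB I b → b ∈ prefA I a
  ∈prefB⇒∈prefA = from (symm _ _)

  inXA-intro : Ms a ≡ just c → T (inXA a)
  inXA-intro e rewrite e = tt

  not-inXA : Ms a ≡ nothing → ¬ T (inXA a)
  not-inXA Msa = subst (T ∘ is-just) Msa

  inXB-intro : Ms a ≡ just b → T (inXB b)
  inXB-intro {a} e = any⁺ _ (lose (∈-allFin a) (T-matchesᵇ⁺ e))

  marked-intro : b ∈ prefA I a → T (mark1 a b ∨ mark2 a b ∨ mark3 a b) → T (marked a b)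
  marked-intro b∈ t = from T-∧ (T-elemᵇ⁺ b∈ , from T-∨ (inj₁ (from T-∧ (T-elemᵇ⁺ b∈ , t))))

  marked-by-rank : T (inXB b) → a ∈ take (suc s) (prefB I b) → b ∈ prefA I a → T (marked a b)
  marked-by-rank {b} {a} b∈XB a∈top b∈ =
    marked-intro b∈ (from (T-∨ {mark1 a b}) (inj₂ (from (T-∨ {mark2 a b})
      (inj₁ (from T-∧ (b∈XB , T-elemᵇ⁺ a∈top))))))

  -- Step (1) if b is an LQ resource, step (3) otherwise.
  marked-by-rival : Ms a ≡ just c → Ms a' ≡ just c' → a' ≢ a →
                    b ∈ prefA I a → b ∈ prefA I a' → T (marked a b)
  marked-by-rival {a} {a' = a'} {b = b} Msa Msa' a'≢a b∈ b∈' = marked-intro b∈ (by-quota (lq I b) refl)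
    where
    by-quota : ∀ q → lq I b ≡ q → T (mark1 a b ∨ mark2 a b ∨ mark3 a b)
    by-quota true  lqb = from (T-∨ {mark1 a b}) (inj₁ (from T-∧ (inXA-intro Msa , from T-≡ lqb)))
    by-quota false lqb = from (T-∨ {mark1 a b}) (inj₂ (from (T-∨ {mark2 a b}) (inj₂
      (from T-∧ (inXA-intro Msa , from T-∧ (from T-not-≡ lqb , any⁺ _ (lose (∈-allFin a')
        (from T-∧ (inXA-intro Msa' , from T-∧ (fromWitnessFalse a'≢a , T-elemᵇ⁺ b∈'))))))))))

  marked-outside-XA : Ms a ≡ nothing → T (marked a b) → T (inXB b) × a ∈ take (suc s) (prefB I b)
  marked-outside-XA {a} {b} Msa t
    with to (T-∨ {mark123 a b}) (proj₂ (to (T-∧ {elemᵇ b (prefA I a)}) t))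
  ... | inj₂ t₄ = ⊥-elim (not-inXA Msa (proj₁ (to (T-∧ {inXA a}) t₄)))
  ... | inj₁ t₁₂₃ with to (T-∨ {mark1 a b}) (proj₂ (to (T-∧ {elemᵇ b (prefA I a)}) t₁₂₃))
  ...   | inj₁ t₁ = ⊥-elim (not-inXA Msa (proj₁ (to (T-∧ {inXA a}) t₁)))
  ...   | inj₂ t₂₃ with to (T-∨ {mark2 a b}) t₂₃
  ...     | inj₂ t₃ = ⊥-elim (not-inXA Msa (proj₁ (to (T-∧ {inXA a}) t₃)))
  ...     | inj₁ t₂ with to (T-∧ {inXB b}) t₂
  ...       | b∈XB , a∈top = b∈XB , T-elemᵇ⁻ _ a∈top

  held-by-better : b ∈ prefA I a → PrefersOpt (prefA I a) b (Ms a) → Ms a ≢ just b →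
                   ∃ λ z → Ms z ≡ just b × Before (prefB I b) z a
  held-by-better {b} {a} b∈ b≻Msa Msa≢b with any? (λ z → ≡-dec _≟_ (Ms z) (just b))
  ... | no unheld =
    ⊥-elim (stable a b (b∈ , Msa≢b , b≻Msa , ∈prefA⇒∈prefB b∈ , λ z Msz → ⊥-elim (unheld (z , Msz))))
  ... | yes (z , Msz)
    with Before-total (∈prefA⇒∈prefB (edge isMs z b Msz)) (∈prefA⇒∈prefB b∈) (λ { refl → Msa≢b Msz })
  ...   | inj₁ z≺a = z , Msz , z≺a
  ...   | inj₂ a≺z = ⊥-elim (stable a b (b∈ , Msa≢b , b≻Msa , ∈prefA⇒∈prefB b∈ , a≻holder))
    where
    a≻holder : ∀ z' → Ms z' ≡ just b → Prefers (prefB I b) a z'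
    a≻holder z' Msz' = Before⇒Prefers (subst (Before _ a) (injRes isMs z z' b Msz Msz') a≺z)

  held-by-better-than-unmatched : Ms a ≡ nothing → b ∈ prefA I a →
                                  ∃ λ z → Ms z ≡ just b × Before (prefB I b) z a
  held-by-better-than-unmatched Msa b∈ =
    held-by-better b∈ (subst (PrefersOpt _ _) (sym Msa) b∈) (λ Msa≡b → case trans (sym Msa) Msa≡b of λ ())

  held-by-better-than-matched : Ms a ≡ just c → Before (prefA I a) b c →
                                ∃ λ z → Ms z ≡ just b × Before (prefB I b) z a
  held-by-better-than-matched {a} Msa b≺c =
    held-by-better (Before⇒∈ˡ b≺c) (subst (PrefersOpt _ _) (sym Msa) (Before⇒Prefers b≺c))
      (λ Msa≡b → Before-irrefl (uniqueA a)
                   (subst (Before _ _) (just-injective (trans (sym Msa) Msa≡b)) b≺c))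

  module Transfer (M' : Matching nA nB) (isM' : IsMatching G' M') (envyFree' : EnvyFree G' M') where

    edge-marked : M' a ≡ just b → b ∈ prefA I a × T (marked a b)
    edge-marked {a} {b} M'a = ∈-filter⁻ (T? ∘ marked a) (edge isM' a b M'a)

    isMatching : IsMatching I M'
    isMatching = record { edge = λ _ _ → proj₁ ∘ edge-marked ; injRes = injRes isM' }

    no-envy' : M' a' ≡ just b → b ∈ prefA I a → T (marked a b) → Before (prefB I b) a a' →
               ¬ PrefersOpt (prefA G' a) b (M' a)
    no-envy' {a'} {b} {a} M'a' b∈ ab-marked a≺a' b≻M'a =
      envyFree' a a' b (M'a' , ∈-filter⁺ (T? ∘ marked a) b∈ ab-marked , b≻M'a ,
        Before⇒Prefers (Before-filter⁺ (λ a → T? (marked a b)) ab-marked (proj₂ (edge-marked M'a')) a≺a'))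

    prefers-own-partner : M' a' ≡ just b → b ∈ prefA I a → T (marked a b) → Before (prefB I b) a a' →
                          ∃ λ d → M' a ≡ just d × Before (prefA I a) d b
    prefers-own-partner {a'} {b} {a} M'a' b∈ ab-marked a≺a'
      with M' a in M'a | no-envy' M'a' b∈ ab-marked a≺a'
    ... | nothing | ¬envy = ⊥-elim (¬envy (∈-filter⁺ (T? ∘ marked a) b∈ ab-marked))
    ... | just d  | ¬envy with edge-marked M'a
    ...   | d∈ , ad-marked with Before-total (∈-filter⁺ (T? ∘ marked a) b∈ ab-marked)
                                             (∈-filter⁺ (T? ∘ marked a) d∈ ad-marked) b≢d
      where
      b≢d : b ≢ d
      b≢d refl =
        Before-irrefl (uniqueB b) (subst (λ x → Before _ x a') (injRes isM' a a' b M'a M'a') a≺a')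
    ...     | inj₁ b≺d = ⊥-elim (¬envy (Before⇒Prefers b≺d))
    ...     | inj₂ d≺b = d , refl , Before-filter⁻ (T? ∘ marked a) (prefA I a) d≺b

    Upgraded : Fin nA → Set
    Upgraded y = ∃₂ λ c d → Ms y ≡ just c × M' y ≡ just d × Before (prefA I y) d c

    upgraded? : Decidable Upgraded
    upgraded? y with Ms y | M' y
    ... | nothing | _ = no λ ()
    ... | just _ | nothing = no λ ()
    ... | just c | just d =
      map′ (λ d≺c → c , d , refl , refl , d≺c) (λ { (_ , _ , refl , refl , d≺c) → d≺c })
           (Before? _≟_ (prefA I y) d c)

    Inherits : Fin nA → Fin nA → Set
    Inherits w z = ∃ λ b → M' w ≡ just b × Ms z ≡ just b

    inherits-injective : ∀ {u v z} → Inherits u z → Inherits v z → u ≡ v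
    inherits-injective {u} {v} {z} (b , M'u , Msz) (b' , M'v , Msz') =
      injRes isM' u v b' (trans M'u (cong just (just-injective (trans (sym Msz) Msz')))) M'v

    holder-upgrades : M' w ≡ just b → Ms z ≡ just b → Before (prefB I b) z w → T (marked z b) →
                      Upgraded z
    holder-upgrades {b = b} M'w Msz z≺w zb-marked
      with prefers-own-partner M'w (∈prefB⇒∈prefA (Before⇒∈ˡ z≺w)) zb-marked z≺w
    ... | d , M'z , d≺b = b , d , Msz , M'z , d≺b

    unmatched-inherits-upgraded : Ms a ≡ nothing → M' a ≡ just c →
                                  ∃ λ z → Inherits a z × Upgraded z
    unmatched-inherits-upgraded {a} {c} Msa M'a with edge-marked M'a
    ... | c∈ , ac-marked with marked-outside-XA Msa ac-marked | held-by-better-than-unmatched Msa c∈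
    ... | c∈XB , a∈top | z , Msz , z≺a =
      z , (c , M'a , Msz) ,
      holder-upgrades M'a Msz z≺a
        (marked-by-rank c∈XB (Before-take (suc s) (uniqueB c) z≺a a∈top) (edge isMs z c Msz))

    upgraded-inherits-upgraded : Upgraded a → ∃ λ z → Inherits a z × Upgraded z
    upgraded-inherits-upgraded {a} (c , d , Msa , M'a , d≺c) with held-by-better-than-matched Msa d≺c
    ... | z , Msz , z≺a =
      z , (d , M'a , Msz) ,
      holder-upgrades M'a Msz z≺a (marked-by-rival Msz Msa a≢z (edge isMs z d Msz) (Before⇒∈ˡ d≺c))
      where
      a≢z : a ≢ z
      a≢z refl = Before-irrefl (uniqueB d) z≺a

    M'-matched⇒Ms-matched : M' a ≡ just c → ∃ λ c' → Ms a ≡ just c'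
    M'-matched⇒Ms-matched {a} M'a with just-or-nothing (Ms a)
    ... | inj₁ matched = matched
    ... | inj₂ Msa =
      ⊥-elim (n≮n (length U) (injective-relation⇒length≤ inherits-injective (a∉U ∷ U!) image))
      where
      U = filter upgraded? (allFin nA)
      U! : Unique U
      U! = filter⁺ upgraded? (allFin⁺ nA)
      upgraded-of-∈U : ∀ {w} → w ∈ U → Upgraded w
      upgraded-of-∈U = proj₂ ∘ ∈-filter⁻ upgraded? {xs = allFin nA}
      a∉U : All (a ≢_) U
      a∉U = ¬Any⇒All¬ U λ a∈U →
        case upgraded-of-∈U a∈U of λ (_ , _ , Msa≡c , _) → case trans (sym Msa) Msa≡c of λ ()
      into-U : ∀ {w} → ∃ (λ z → Inherits w z × Upgraded z) → ∃ λ z → z ∈ U × Inherits w z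
      into-U (z , w→z , z-up) = z , ∈-filter⁺ upgraded? (∈-allFin z) z-up , w→z
      image : ∀ {w} → w ∈ a ∷ U → ∃ λ z → z ∈ U × Inherits w z
      image (here refl) = into-U (unmatched-inherits-upgraded Msa M'a)
      image (there w∈U) = into-U (upgraded-inherits-upgraded (upgraded-of-∈U w∈U))

    -- Otherwise b's first s + 1 agents, all ranked above a, would be matched under M' and hence
    -- under Ms, though |X_A| = s.
    ranked-among-first : M' a' ≡ just b → Before (prefB I b) a a' → T (inXB b) →
                   a ∈ take (suc s) (prefB I b)
    ranked-among-first {a'} {b} {a} M'a' a≺a' b∈XB with Any.any? (a ≟_) (take (suc s) (prefB I b))
    ... | yes a∈top = a∈top
    ... | no a∉top =
      ⊥-elim (n≮n s (subst (_≤ s) (length-take-∉ (suc s) (prefB I b) (Before⇒∈ˡ a≺a') a∉top)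
        (injective-relation⇒length≤ (λ u≡w v≡w → trans u≡w (sym v≡w))
          (take⁺ (suc s) (uniqueB b)) top⊆XA)))
      where
      top⊆XA : ∀ {w} → w ∈ take (suc s) (prefB I b) →
               ∃ λ w' → w' ∈ filter (T? ∘ inXA) (allFin nA) × w ≡ w'
      top⊆XA {w} w∈top with prefers-own-partner M'a' (∈prefB⇒∈prefA w∈) wb-marked w≺a'
        where
        w∈ = ∈-take⁻ (suc s) (prefB I b) w∈top
        w≺a' = Before-trans (uniqueB b)
                 (take-Before (suc s) (prefB I b) w∈top (Before⇒∈ˡ a≺a') a∉top) a≺a'
        wb-marked = marked-by-rank b∈XB w∈top (∈prefB⇒∈prefA w∈)
      ... | _ , M'w , _ with M'-matched⇒Ms-matched M'w
      ...   | _ , Msw = w , ∈-filter⁺ (T? ∘ inXA) (∈-allFin w) (inXA-intro Msw) , refl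

    envier-marked : M' a' ≡ just b → b ∈ prefA I a → Before (prefB I b) a a' → T (marked a b)
    envier-marked {a'} {b} {a} M'a' b∈ a≺a' with M'-matched⇒Ms-matched M'a' | just-or-nothing (Ms a)
    ... | _ , Msa' | inj₁ (_ , Msa) =
      marked-by-rival Msa Msa' (λ { refl → Before-irrefl (uniqueB b) a≺a' }) b∈ (proj₁ (edge-marked M'a'))
    ... | _ | inj₂ Msa with held-by-better-than-unmatched Msa b∈
    ...   | _ , Msz , _ = marked-by-rank (inXB-intro Msz) (ranked-among-first M'a' a≺a' (inXB-intro Msz)) b∈

    envyFree : EnvyFree I M'
    envyFree a a' b (M'a' , b∈ , b≻M'a , a≻a')
      with prefers-own-partner M'a' b∈ (envier-marked M'a' b∈ a≺a') a≺a'
      where a≺a' = Prefers⇒Before _ a≻a'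
    ... | d , M'a , d≺b =
      Before-asym (uniqueA a) d≺b (Prefers⇒Before _ (subst (PrefersOpt _ b) M'a b≻M'a))

lemma4 : {nA nB : ℕ} (I : Instance nA nB) → WellFormed I →
         (Ms : Matching nA nB) → IsMatching I Ms → Stable I Ms →
         (k : ℕ) →
         (∃ λ (M' : Matching nA nB) →
            IsMatching (markedInstance I Ms) M' × Feasible (markedInstance I Ms) M' ×
            EnvyFree (markedInstance I Ms) M' × size M' ≡ k) →
         ∃ λ (M : Matching nA nB) →
            IsMatching I M × Feasible I M × EnvyFree I M × size M ≡ k
lemma4 I wf Ms isMs stable k (M' , isM' , feasible' , envyFree' , size≡k) =
  M' , isMatching , feasible' , envyFree , size≡k
  where open MarkedInstance.Transfer I wf Ms isMs stable M' isM' envyFree'
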